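{- Let $q$ be a prime power and let $k\ge 2$ and $n \geq 2k+1$ be integers, and let $m = k+1$. Then for every integer $i$ with $1 \leq i \leq k$ we have $d_{i0} \geq 2$, where \[ d_{i0} = \sum_{r=b}^{B} q^{r(r-1+2i)/2}\begin{bmatrix} m-i \\ r\end{bmatrix}_q \begin{bmatrix} k-i \\ r\end{bmatrix}_q (q)_r \cdot q^{s(s+m-i)}\begin{bmatrix} n-m-k+i \\ s\end{bmatrix}_q, \] with $s = k - r$, $b = \max\{0,\, m+2k-n-i\}$ and $B = \min\{m-i,\, k-i,\, k\}$.
   Context: For a prime power $q$ and integer $N\ge 1$, $(q)_N := \prod_{t=1}^{N}(q^t-1)$, and $(q)_0 := 1$. The Gaussian binomial coefficient is $\begin{bmatrix} N \\ K\end{bmatrix}_q := \frac{(q)_N}{(q)_K (q)_{N-K}}$ for $0\le K\le N$, with $\begin{bmatrix} N \\ 0\end{bmatrix}_q = \begin{bmatrix} 0 \\ 0\end{bmatrix}_q=1$ and $\begin{bmatrix} N \\ K\end{bmatrix}_q = 0$ if $K > N$. An empty sum (when $b > B$) equals $0$. (This is the general quantity $d_{ij}=q^{ij}\begin{bmatrix} m-i \\ j\end{bmatrix}_q\sum_{r=b}^{B} q^{r(r-1+2i)/2}\begin{bmatrix} m-i-j \\ r\end{bmatrix}_q\begin{bmatrix} k-i \\ r\end{bmatrix}_q (q)_r\, q^{s(s+m-i)}\begin{bmatrix} n-m-k+i \\ s\end{bmatrix}_q$, $s=k-j-r$, $b=\max\{0,m+2k-n-i-j\}$, $B=\min\{m-i-j,k-i,k-j\}$,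 specialized to $j=0$.) -}

module Defs where

open import Data.Nat using (ℕ; zero; suc; _+_; _*_; _∸_; _^_; _≤_; _<_; _⊓_; _⊔_; _≤ᵇ_)
open import Data.Nat.DivMod using (_/_)
open import Data.Nat.Primality using (Prime)
open import Data.Product using (Σ; _×_)
open import Data.List using (List; map; upTo)
open import Data.Nat.ListAction using (sum)
open import Data.Bool using (if_then_else_)
open import Relation.Binary.PropositionalEquality using (_≡_)

IsPrimePower : ℕ → Set
IsPrimePower q = Σ ℕ λ p → Σ ℕ λ e → Prime p × (1 ≤ e) × (q ≡ p ^ e)

qPoch : ℕ → ℕ → ℕ
qPoch q zero    = 1
qPoch q (suc N) = qPoch q N * (q ^ suc N ∸ 1)

-- natural-number division, with the (unused) convention a / 0 = 0
divℕ : ℕ → ℕ → ℕ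
divℕ a zero    = 0
divℕ a (suc b) = a / suc b

gauss : ℕ → ℕ → ℕ → ℕ
gauss q N K = if K ≤ᵇ N then divℕ (qPoch q N) (qPoch q K * qPoch q (N ∸ K)) else 0

-- Σ_{r=b}^{B} f r  (empty sum = 0 when b > B)
sumFromTo : ℕ → ℕ → (ℕ → ℕ) → ℕ
sumFromTo b B f = sum (map (λ t → f (b + t)) (upTo (suc B ∸ b)))

-- d_{i0} with m = k+1 (general m argument kept); requires i ≥ 1, r ≤ k, n ≥ m+k-i
-- so all truncated subtractions below are genuine subtractions.
-- b = max{0, m+2k-n-i} is (m+2k) ∸ (n+i) in ℕ.
d-i0 : (q n k m i : ℕ) → ℕ
d-i0 q n k m i =
  sumFromTo ((m + 2 * k) ∸ (n + i)) ((m ∸ i) ⊓ (k ∸ i) ⊓ k) λ r →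
    let s = k ∸ r in
    q ^ ((r * (r + 2 * i ∸ 1)) / 2)
      * gauss q (m ∸ i) r * gauss q (k ∸ i) r * qPoch q r
      * (q ^ (s * (s + (m ∸ i))) * gauss q (n ∸ m ∸ k + i) s)

-- Only one summand is needed: at r = k − i we get s = i ≥ 1, so the factor
-- q ^ (s (s + m − i)) is at least q ≥ 2, while every other factor (powers of q,
-- q-Pochhammer symbols and Gaussian binomials in range) is at least 1.
module Submission where

open import Defs
open import Data.Nat using (ℕ; _+_; _*_; _≤_)
open import Relation.Binary.PropositionalEquality using (_≡_)

open import Data.Nat using (zero; suc; _∸_; _^_; _<_; _⊓_; _≤ᵇ_; NonZero; >-nonZero; z<s; s≤s)
open import Data.Nat.Properties
open import Data.Nat.DivMod using (_/_; m≥n⇒m/n>0)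
open import Data.Nat.Primality using (prime⇒nonTrivial)
open import Data.Nat.Base using (nonTrivial⇒n>1)
open import Data.Nat.ListAction using (sum)
open import Data.List using ([]; _∷_; map; upTo)
open import Data.Nat.Tactic.RingSolver using (solve)
open import Data.List.Relation.Unary.Any using (here; there)
open import Data.List.Membership.Propositional using (_∈_)
open import Data.List.Membership.Propositional.Properties using (∈-map⁺; ∈-upTo⁺)
open import Data.Product using (_,_)
open import Data.Bool using (true)
open import Relation.Binary.PropositionalEquality using (refl; sym; trans; cong; subst)

∈⇒≤sum : ∀ {n ns} → n ∈ ns → n ≤ sum ns
∈⇒≤sum {ns = n ∷ ns} (here refl)  = m≤m+n n (sum ns)
∈⇒≤sum {ns = m ∷ ns} (there n∈ns) = m≤n⇒m≤o+n m (∈⇒≤sum n∈ns)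

≤sumFromTo : ∀ {b B} (f : ℕ → ℕ) → b ≤ B → f B ≤ sumFromTo b B f
≤sumFromTo {b} {B} f b≤B =
  subst (λ r → f r ≤ sumFromTo b B f) (m+[n∸m]≡n b≤B)
    (∈⇒≤sum (∈-map⁺ (λ t → f (b + t)) (∈-upTo⁺ B∸b<1+B∸b)))
  where
  B∸b<1+B∸b : B ∸ b < suc B ∸ b
  B∸b<1+B∸b = subst (B ∸ b <_) (sym (+-∸-assoc 1 b≤B)) ≤-refl

primePower⇒>1 : ∀ {q} → IsPrimePower q → 1 < q
primePower⇒>1 (p , e , p-prime , 1≤e , refl) =
  ^-monoʳ-< p (nonTrivial⇒n>1 p {{prime⇒nonTrivial p-prime}}) 1≤e

qPoch-*-≤ : ∀ q .{{_ : NonZero q}} K L → qPoch q K * qPoch q L ≤ qPoch q (K + L)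
qPoch-*-≤ q K zero = ≤-reflexive (trans (*-identityʳ _) (cong (qPoch q) (sym (+-identityʳ K))))
qPoch-*-≤ q K (suc L) = begin
  qPoch q K * (qPoch q L * (q ^ suc L ∸ 1))  ≡⟨ *-assoc (qPoch q K) _ _ ⟨
  qPoch q K * qPoch q L * (q ^ suc L ∸ 1)    ≤⟨ *-mono-≤ (qPoch-*-≤ q K L)
                                                  (∸-monoˡ-≤ 1 (^-monoʳ-≤ q (s≤s (m≤n+m L K)))) ⟩
  qPoch q (K + L) * (q ^ suc (K + L) ∸ 1)    ≡⟨ cong (qPoch q) (+-suc K L) ⟨
  qPoch q (K + suc L)                        ∎
  where open ≤-Reasoning

divℕ-pos : ∀ {a b} → 0 < b → b ≤ a → 0 < divℕ a b
divℕ-pos {b = suc _} _ b≤a = m≥n⇒m/n>0 b≤a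

-- Definitionally the summand of d-i0, so d-i0 unfolds to a sumFromTo of it.
d-i0-summand : (q n k m i r : ℕ) → ℕ
d-i0-summand q n k m i r = let s = k ∸ r in
  q ^ ((r * (r + 2 * i ∸ 1)) / 2)
    * gauss q (m ∸ i) r * gauss q (k ∸ i) r * qPoch q r
    * (q ^ (s * (s + (m ∸ i))) * gauss q (n ∸ m ∸ k + i) s)

module _ {q : ℕ} (1<q : 1 < q) where

  private instance
    q≢0 : NonZero q
    q≢0 = >-nonZero (<-trans z<s 1<q)

  qPoch-pos : ∀ N → 0 < qPoch q N
  qPoch-pos zero    = z<s
  qPoch-pos (suc N) = *-mono-≤ (qPoch-pos N) (m<n⇒0<n∸m (^-monoʳ-< q 1<q (z<s {N})))

  gauss-pos : ∀ {N K} → K ≤ N → 0 < gauss q N K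
  gauss-pos {N} {K} K≤N with K ≤ᵇ N | ≤⇒≤ᵇ K≤N
  ... | true | _ = divℕ-pos (*-mono-≤ (qPoch-pos K) (qPoch-pos (N ∸ K)))
    (subst (λ M → qPoch q K * qPoch q (N ∸ K) ≤ qPoch q M) (m+[n∸m]≡n K≤N) (qPoch-*-≤ q K (N ∸ K)))

  2≤d-i0-summand : ∀ {n k m i r} → r ≤ m ∸ i → r ≤ k ∸ i → r < k → k ∸ r ≤ n ∸ m ∸ k + i →
    2 ≤ d-i0-summand q n k m i r
  2≤d-i0-summand {n} {k} {m} {i} {r} r≤m∸i r≤k∸i r<k s≤n∸m∸k+i =
    *-mono-≤ first-factors-pos (*-mono-≤ 1<q^e (gauss-pos s≤n∸m∸k+i))
    where
    0<s : 0 < k ∸ r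
    0<s = m<n⇒0<n∸m r<k
    first-factors-pos : 0 < q ^ ((r * (r + 2 * i ∸ 1)) / 2)
                              * gauss q (m ∸ i) r * gauss q (k ∸ i) r * qPoch q r
    first-factors-pos = *-mono-≤ (*-mono-≤ (*-mono-≤ (m^n>0 q ((r * (r + 2 * i ∸ 1)) / 2))
      (gauss-pos r≤m∸i)) (gauss-pos r≤k∸i)) (qPoch-pos r)
    1<q^e : 1 < q ^ ((k ∸ r) * (k ∸ r + (m ∸ i)))
    1<q^e = ^-monoʳ-< q 1<q (*-mono-≤ 0<s (m≤n⇒m≤n+o (m ∸ i) 0<s))

d-i0-summand[k∸i]≤d-i0 : ∀ {q n k i} → 2 * k + 1 ≤ n → i ≤ k →
  d-i0-summand q n k (k + 1) i (k ∸ i) ≤ d-i0 q n k (k + 1) i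
d-i0-summand[k∸i]≤d-i0 {q} {n} {k} {i} 2k+1≤n i≤k = begin
  f (k ∸ i)             ≤⟨ ≤sumFromTo f b≤k∸i ⟩
  sumFromTo b (k ∸ i) f ≡⟨ cong (λ B → sumFromTo b B f) B≡k∸i ⟨
  d-i0 q n k (k + 1) i  ∎
  where
  open ≤-Reasoning
  f : ℕ → ℕ
  f = d-i0-summand q n k (k + 1) i
  b : ℕ
  b = (k + 1 + 2 * k) ∸ (n + i)
  B≡k∸i : (k + 1 ∸ i) ⊓ (k ∸ i) ⊓ k ≡ k ∸ i
  B≡k∸i = trans (cong (_⊓ k) (m≥n⇒m⊓n≡n (∸-monoˡ-≤ i (m≤m+n k 1)))) (m≤n⇒m⊓n≡m (m∸n≤m k i))
  b≤k∸i : b ≤ k ∸ i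
  b≤k∸i = begin
    (k + 1 + 2 * k) ∸ (n + i)          ≤⟨ ∸-monoʳ-≤ (k + 1 + 2 * k) (+-monoˡ-≤ i 2k+1≤n) ⟩
    (k + 1 + 2 * k) ∸ (2 * k + 1 + i)  ≡⟨ cong (_∸ (2 * k + 1 + i)) (solve (k ∷ [])) ⟩
    (2 * k + 1 + k) ∸ (2 * k + 1 + i)  ≡⟨ [m+n]∸[m+o]≡n∸o (2 * k + 1) k i ⟩
    k ∸ i                              ∎

lemma2p2 : (q n k m i : ℕ) → IsPrimePower q → 2 ≤ k → 2 * k + 1 ≤ n → m ≡ k + 1 →
    1 ≤ i → i ≤ k → 2 ≤ d-i0 q n k m i
lemma2p2 q n k .(k + 1) i q-pp _ 2k+1≤n refl 0<i i≤k = begin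
  2                                     ≤⟨ 2≤d-i0-summand (primePower⇒>1 q-pp) r≤k+1∸i ≤-refl r<k s≤n∸m∸k+i ⟩
  d-i0-summand q n k (k + 1) i (k ∸ i)  ≤⟨ d-i0-summand[k∸i]≤d-i0 2k+1≤n i≤k ⟩
  d-i0 q n k (k + 1) i                  ∎
  where
  open ≤-Reasoning
  r≤k+1∸i : k ∸ i ≤ k + 1 ∸ i
  r≤k+1∸i = ∸-monoˡ-≤ i (m≤m+n k 1)
  r<k : k ∸ i < k
  r<k = ∸-monoʳ-< 0<i i≤k
  s≤n∸m∸k+i : k ∸ (k ∸ i) ≤ n ∸ (k + 1) ∸ k + i
  s≤n∸m∸k+i = subst (_≤ n ∸ (k + 1) ∸ k + i) (sym (m∸[m∸n]≡n i≤k)) (m≤n+m i _)
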